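{- Let $n$ be even and let $z,y$ be skew-symmetric $n\times n$ complex matrices. Then $$\sum_{I\subseteq[n]}\mathrm{Pfaff}(z_I)\,\mathrm{Pfaff}(y_{[n]\setminus I})=\mathrm{Pfaff}(\tilde z+y),$$ i.e. $\langle\mathrm{sPf}(z),\mathrm{sPf}^{\vee}(y)\rangle=\mathrm{Pfaff}(\tilde z+y)$.
   Context: For $I\subseteq[n]$, $z_I$ is the principal submatrix of $z$ with rows and columns indexed by $I$ (in increasing order); $\mathrm{Pfaff}$ of the empty matrix is $1$ and of an odd-size matrix is $0$. $\mathrm{sPf}(z)\in\mathbb{C}^{2^n}$ has coordinates $\mathrm{sPf}(z)_I=\mathrm{Pfaff}(z_I)$, $\mathrm{sPf}^{\vee}(y)_I=\mathrm{Pfaff}(y_{[n]\setminus I})$, and $\langle u,v\rangle=\sum_{I\subseteq[n]}u_Iv_I$. The matrix $\tilde z$ is defined by $\tilde z_{ij}=(-1)^{i+j+1}z_{ij}$. -}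

module Defs where

open import Level using (Level)
open import Algebra.Bundles using (CommutativeRing)
open import Data.Nat using (ℕ; zero; suc) renaming (_+_ to _+ℕ_)
open import Data.Fin using (Fin; zero; suc; toℕ; punchIn)
open import Data.Fin.Subset using (Subset; inside; outside; ∁)
open import Data.Vec using ([]; _∷_)
open import Data.List using (List; []; _∷_; length; map; lookup)

elems : ∀ {n} → Subset n → List (Fin n)
elems []              = []
elems (inside  ∷ s)   = zero ∷ map suc (elems s)
elems (outside ∷ s)   = map suc (elems s)

module WithRing {c ℓ : Level} (R : CommutativeRing c ℓ) where
  open CommutativeRing R using (Carrier; _≈_; _+_; _*_; -_; 0#; 1#)

  Matrix : ℕ → Set c
  Matrix m = Fin m → Fin m → Carrier

  Σ : ∀ {m} → (Fin m → Carrier) → Carrier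
  Σ {zero}  f = 0#
  Σ {suc m} f = f zero + Σ (λ i → f (suc i))

  sgn : ℕ → Carrier → Carrier
  sgn zero    x = x
  sgn (suc k) x = - sgn k x

  -- Pfaffian, by expansion along the first row:
  --   Pf(A) = Σ_{j=2}^{m} (-1)^j a_{1j} Pf(A with rows/cols 1, j deleted),
  -- Pf of the empty matrix is 1, Pf of a 1×1 (hence of any odd-size) matrix is 0.
  Pfaff : (m : ℕ) → Matrix m → Carrier
  Pfaff zero          A = 1#
  Pfaff (suc zero)    A = 0#
  Pfaff (suc (suc m)) A =
    Σ (λ (k : Fin (suc m)) →
         sgn (toℕ k) (A zero (suc k) *
           Pfaff m (λ i j → A (suc (punchIn k i)) (suc (punchIn k j)))))

  principal : ∀ {n} → Matrix n → (I : Subset n) → Matrix (length (elems I))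
  principal z I i j = z (lookup (elems I) i) (lookup (elems I) j)

  PfSub : ∀ {n} → Matrix n → Subset n → Carrier
  PfSub z I = Pfaff (length (elems I)) (principal z I)

  ΣSubsets : (n : ℕ) → (Subset n → Carrier) → Carrier
  ΣSubsets zero    f = f []
  ΣSubsets (suc n) f = ΣSubsets n (λ s → f (outside ∷ s)) + ΣSubsets n (λ s → f (inside ∷ s))

  sPf : ∀ {n} → Matrix n → Subset n → Carrier
  sPf z I = PfSub z I

  sPf∨ : ∀ {n} → Matrix n → Subset n → Carrier
  sPf∨ y I = PfSub y (∁ I)

  ⟨_,_⟩ : ∀ {n} → (Subset n → Carrier) → (Subset n → Carrier) → Carrier
  ⟨_,_⟩ {n} u v = ΣSubsets n (λ I → u I * v I)

  -- z̃_ij = (-1)^{i+j+1} z_ij  (0-based indices give the same parity as 1-based)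
  tilde : ∀ {n} → Matrix n → Matrix n
  tilde z i j = sgn (toℕ i +ℕ toℕ j +ℕ 1) (z i j)

  _⊕_ : ∀ {n} → Matrix n → Matrix n → Matrix n
  (A ⊕ B) i j = A i j + B i j

  SkewSymmetric : ∀ {n} → Matrix n → Set ℓ
  SkewSymmetric A = ∀ i j → A i j ≈ - A j i

module Submission where

-- Writing D = diag((-1)^i) one has z̃ = -DzD, and the theorem is the case wᵢ = (-1)^i of
--   Pf(-WzW + y) = Σ_I (∏_{i∈I} (-1)^i wᵢ) Pf(z_I) Pf(y_{[n]∖I}),   W = diag(w),
-- which holds for all weights w, by induction on n. Expanding the left side along the first
-- row gives Σ_k (-1)^k (y₀ₖ - w₀wₖz₀ₖ) Pf(M_k), where the minor M_k is again of the form
-- -W′z′W′ + y′. On the right, split according to whether 0 ∈ I, expand Pf(z_I) resp.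
-- Pf(y_{[n]∖I}) along its first row and collect the terms by the partner k of 0. Deleting 0
-- and k lowers by one the index of every element below k, flipping its weight (-1)^i; these
-- flips and the sign of the first-row expansion on the right combine to (-1)^k.

open import Level using (Level)
open import Algebra.Bundles using (CommutativeRing)
open import Data.Bool.Base using (if_then_else_; not)
open import Data.Fin.Base using (Fin; zero; suc; toℕ; punchIn; cast; inject₁)
open import Data.Fin.Properties using (cast-is-id)
open import Data.Fin.Subset using (Subset; inside; outside; ∁; _-_)
open import Data.Fin.Subset.Properties using (p─⊥≡p)
open import Data.List.Base using (List; []; _∷_; length; map; lookup; removeAt)
open import Data.List.Properties using (length-map; length-removeAt′; map-∘)
open import Data.Nat using (ℕ; zero; suc)
import Data.Nat.Base as ℕ
open import Data.Nat.Properties using (+-suc; suc-injective)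
open import Data.Product.Base using (∃-syntax; _×_; _,_)
open import Data.Vec.Base using ([]; _∷_; insertAt)
import Data.Vec.Base as Vec
open import Data.Vec.Properties using (insertAt-lookup; map-insertAt)
open import Function.Base using (_∘_)
open import Relation.Binary.PropositionalEquality as ≡ using (_≡_)
open import Defs

module PfaffianExpansion {c ℓ : Level} (R : CommutativeRing c ℓ) where

  open CommutativeRing R hiding (zero; _-_)
  open WithRing R
  open import Algebra.Properties.Ring ring using (-‿distribˡ-*; -‿distribʳ-*; -‿+-comm; -‿involutive)
  open import Algebra.Properties.Semiring.Sum semiring using (sum; sum-cong-≋; ∑-distrib-+; *-distribˡ-sum)
  open import Algebra.Properties.CommutativeSemigroup +-commutativeSemigroup
    using () renaming (interchange to +-interchange)
  open import Algebra.Properties.CommutativeSemigroup *-commutativeSemigroup using (x∙yz≈y∙xz; x∙yz≈xz∙y)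
  open import Algebra.Solver.CommutativeMonoid *-commutativeMonoid using (solve; _⊜_) renaming (_⊕_ to _·_)
  open import Relation.Binary.Reasoning.Setoid setoid

  sgn-cong : ∀ a {x y} → x ≈ y → sgn a x ≈ sgn a y
  sgn-cong zero    x≈y = x≈y
  sgn-cong (suc a) x≈y = -‿cong (sgn-cong a x≈y)

  sgn-+ : ∀ a b x → sgn (a ℕ.+ b) x ≡ sgn a (sgn b x)
  sgn-+ zero    b x = ≡.refl
  sgn-+ (suc a) b x = ≡.cong -_ (sgn-+ a b x)

  sgn-neg : ∀ a x → sgn a (- x) ≡ - sgn a x
  sgn-neg zero    x = ≡.refl
  sgn-neg (suc a) x = ≡.cong -_ (sgn-neg a x)

  sgn-involutive : ∀ a x → sgn a (sgn a x) ≈ x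
  sgn-involutive zero    x = refl
  sgn-involutive (suc a) x = begin
    - sgn a (- sgn a x)  ≡⟨ ≡.cong -_ (sgn-neg a (sgn a x)) ⟩
    - - sgn a (sgn a x)  ≈⟨ -‿involutive _ ⟩
    sgn a (sgn a x)      ≈⟨ sgn-involutive a x ⟩
    x                    ∎

  sgn-*ˡ : ∀ a x y → sgn a x * y ≈ sgn a (x * y)
  sgn-*ˡ zero    x y = refl
  sgn-*ˡ (suc a) x y = trans (sym (-‿distribˡ-* _ y)) (-‿cong (sgn-*ˡ a x y))

  sgn-*ʳ : ∀ a x y → x * sgn a y ≈ sgn a (x * y)
  sgn-*ʳ zero    x y = refl
  sgn-*ʳ (suc a) x y = trans (sym (-‿distribʳ-* x _)) (-‿cong (sgn-*ʳ a x y))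

  sgn-*-sgn : ∀ a b x y → sgn a x * sgn b y ≈ sgn a (sgn b (x * y))
  sgn-*-sgn a b x y = trans (sgn-*ˡ a x _) (sgn-cong a (sgn-*ʳ b x y))

  sgn-distrib-+ : ∀ a x y → sgn a (x + y) ≈ sgn a x + sgn a y
  sgn-distrib-+ zero    x y = refl
  sgn-distrib-+ (suc a) x y = trans (-‿cong (sgn-distrib-+ a x y)) (sym (-‿+-comm _ _))

  Σ≡sum : ∀ {m} (f : Fin m → Carrier) → Σ f ≡ sum f
  Σ≡sum {zero}  f = ≡.refl
  Σ≡sum {suc m} f = ≡.cong (f zero +_) (Σ≡sum (f ∘ suc))

  Σ-cong : ∀ {m} {f g : Fin m → Carrier} → (∀ i → f i ≈ g i) → Σ f ≈ Σ g
  Σ-cong {f = f} {g} f≈g rewrite Σ≡sum f | Σ≡sum g = sum-cong-≋ f≈g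

  Σ-distrib-+ : ∀ {m} (f g : Fin m → Carrier) → Σ (λ i → f i + g i) ≈ Σ f + Σ g
  Σ-distrib-+ f g rewrite Σ≡sum (λ i → f i + g i) | Σ≡sum f | Σ≡sum g = ∑-distrib-+ f g

  *-distribˡ-Σ : ∀ {m} x (f : Fin m → Carrier) → x * Σ f ≈ Σ (λ i → x * f i)
  *-distribˡ-Σ x f rewrite Σ≡sum f | Σ≡sum (λ i → x * f i) = *-distribˡ-sum x f

  ΣSubsets-cong : ∀ n {f g : Subset n → Carrier} → (∀ s → f s ≈ g s) → ΣSubsets n f ≈ ΣSubsets n g
  ΣSubsets-cong zero    f≈g = f≈g []
  ΣSubsets-cong (suc n) f≈g =
    +-cong (ΣSubsets-cong n (f≈g ∘ (outside ∷_))) (ΣSubsets-cong n (f≈g ∘ (inside ∷_)))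

  ΣSubsets-zero : ∀ n {f : Subset n → Carrier} → (∀ s → f s ≈ 0#) → ΣSubsets n f ≈ 0#
  ΣSubsets-zero zero    f≈0 = f≈0 []
  ΣSubsets-zero (suc n) f≈0 =
    trans (+-cong (ΣSubsets-zero n (f≈0 ∘ (outside ∷_))) (ΣSubsets-zero n (f≈0 ∘ (inside ∷_))))
          (+-identityˡ 0#)

  *-distribˡ-ΣSubsets : ∀ n x (f : Subset n → Carrier) → x * ΣSubsets n f ≈ ΣSubsets n (λ s → x * f s)
  *-distribˡ-ΣSubsets zero    x f = refl
  *-distribˡ-ΣSubsets (suc n) x f =
    trans (distribˡ x _ _) (+-cong (*-distribˡ-ΣSubsets n x _) (*-distribˡ-ΣSubsets n x _))

  ΣSubsets-Σ-comm : ∀ n {m} (f : Subset n → Fin m → Carrier) →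
    ΣSubsets n (λ s → Σ (f s)) ≈ Σ (λ k → ΣSubsets n (λ s → f s k))
  ΣSubsets-Σ-comm zero    f = refl
  ΣSubsets-Σ-comm (suc n) f =
    trans (+-cong (ΣSubsets-Σ-comm n (f ∘ (outside ∷_))) (ΣSubsets-Σ-comm n (f ∘ (inside ∷_))))
          (sym (Σ-distrib-+ (λ k → ΣSubsets n (λ s → f (outside ∷ s) k))
                            (λ k → ΣSubsets n (λ s → f (inside ∷ s) k))))

  ΣSubsets-insertAt : ∀ m (k : Fin (suc m)) (f : Subset (suc m) → Carrier) →
    ΣSubsets (suc m) f ≈
    ΣSubsets m (λ t → f (insertAt t k outside)) + ΣSubsets m (λ t → f (insertAt t k inside))
  ΣSubsets-insertAt m       zero    f = refl
  ΣSubsets-insertAt (suc m) (suc k) f =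
    trans (+-cong (ΣSubsets-insertAt m k (f ∘ (outside ∷_))) (ΣSubsets-insertAt m k (f ∘ (inside ∷_))))
          (+-interchange _ _ _ _)

  ΣSubsets-∁ : ∀ n (f : Subset n → Carrier) → ΣSubsets n f ≈ ΣSubsets n (f ∘ ∁)
  ΣSubsets-∁ zero    f = refl
  ΣSubsets-∁ (suc n) f =
    trans (+-comm _ _) (+-cong (ΣSubsets-∁ n (f ∘ (inside ∷_))) (ΣSubsets-∁ n (f ∘ (outside ∷_))))

  ∁-involutive : ∀ {n} (s : Subset n) → ∁ (∁ s) ≡ s
  ∁-involutive []            = ≡.refl
  ∁-involutive (inside  ∷ s) = ≡.cong (inside ∷_) (∁-involutive s)
  ∁-involutive (outside ∷ s) = ≡.cong (outside ∷_) (∁-involutive s)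

  rank : ∀ {n} → Subset n → Fin (suc n) → ℕ
  rank t             zero    = 0
  rank (inside  ∷ t) (suc k) = suc (rank t k)
  rank (outside ∷ t) (suc k) = rank t k

  rank-insertAt : ∀ {m} (t : Subset m) k b → rank (insertAt t k b) (inject₁ k) ≡ rank t k
  rank-insertAt t             zero    b = ≡.refl
  rank-insertAt (inside  ∷ t) (suc k) b = ≡.cong suc (rank-insertAt t k b)
  rank-insertAt (outside ∷ t) (suc k) b = rank-insertAt t k b

  rank-∁ : ∀ {m} (t : Subset m) k → rank (∁ t) k ℕ.+ rank t k ≡ toℕ k
  rank-∁ t             zero    = ≡.refl
  rank-∁ (inside  ∷ t) (suc k) = ≡.trans (+-suc (rank (∁ t) k) (rank t k)) (≡.cong suc (rank-∁ t k))
  rank-∁ (outside ∷ t) (suc k) = ≡.cong suc (rank-∁ t k)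

  insertAt-remove : ∀ {m} (t : Subset m) k b → insertAt t k b - k ≡ insertAt t k outside
  insertAt-remove t       zero    b = ≡.cong (outside ∷_) (p─⊥≡p t)
  insertAt-remove (x ∷ t) (suc k) b = ≡.cong (x ∷_) (insertAt-remove t k b)

  map-suc-punchIn : ∀ {m} (k : Fin (suc m)) l → map suc (map (punchIn k) l) ≡ map (punchIn (suc k)) (map suc l)
  map-suc-punchIn k l = ≡.trans (≡.sym (map-∘ l)) (map-∘ l)

  elems-insertAt-outside : ∀ {m} (t : Subset m) k → elems (insertAt t k outside) ≡ map (punchIn k) (elems t)
  elems-insertAt-outside t             zero    = ≡.refl
  elems-insertAt-outside (outside ∷ t) (suc k) =
    ≡.trans (≡.cong (map suc) (elems-insertAt-outside t k)) (map-suc-punchIn k (elems t))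
  elems-insertAt-outside (inside  ∷ t) (suc k) =
    ≡.cong (zero ∷_) (≡.trans (≡.cong (map suc) (elems-insertAt-outside t k)) (map-suc-punchIn k (elems t)))

  skip : ∀ {m} → Fin (suc m) → Fin m → Fin (suc (suc m))
  skip k i = suc (punchIn k i)

  minor : ∀ {m} → Fin (suc m) → Matrix (suc (suc m)) → Matrix m
  minor k A i j = A (skip k i) (skip k j)

  Pfaff-cong : ∀ m {A B : Matrix m} → (∀ i j → A i j ≈ B i j) → Pfaff m A ≈ Pfaff m B
  Pfaff-cong zero          A≈B = refl
  Pfaff-cong (suc zero)    A≈B = refl
  Pfaff-cong (suc (suc m)) A≈B = Σ-cong λ k → sgn-cong (toℕ k)
    (*-cong (A≈B zero (suc k)) (Pfaff-cong m λ i j → A≈B (skip k i) (skip k j)))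

  Pfaff-cast : ∀ {m m′} (m≡m′ : m ≡ m′) (A : Matrix m) (B : Matrix m′) →
    (∀ i j → A i j ≈ B (cast m≡m′ i) (cast m≡m′ j)) → Pfaff m A ≈ Pfaff m′ B
  Pfaff-cast {m} ≡.refl A B A≈B = Pfaff-cong m λ i j →
    trans (A≈B i j) (reflexive (≡.cong₂ B (cast-is-id ≡.refl i) (cast-is-id ≡.refl j)))

  -- PfSub A I unfolds to PfList A (elems I).
  PfList : ∀ {n} → Matrix n → List (Fin n) → Carrier
  PfList A l = Pfaff (length l) (λ i j → A (lookup l i) (lookup l j))

  ΣPick : ∀ {n} → List (Fin n) → (ℕ → Fin n → List (Fin n) → Carrier) → Carrier
  ΣPick l K = Σ {length l} (λ p → K (toℕ p) (lookup l p) (removeAt l p))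

  lookup-removeAt : ∀ {n} (b : Fin n) r (p : Fin (suc (length r))) (i : Fin (length r)) →
    lookup (removeAt (b ∷ r) p) (cast (suc-injective (length-removeAt′ (b ∷ r) p)) i) ≡
    lookup (b ∷ r) (punchIn p i)
  lookup-removeAt b r       zero    i       = ≡.cong (lookup r) (cast-is-id ≡.refl i)
  lookup-removeAt b (c ∷ r) (suc p) zero    = ≡.refl
  lookup-removeAt b (c ∷ r) (suc p) (suc i) = lookup-removeAt c r p i

  PfList-∷ : ∀ {n} (A : Matrix n) a l → PfList A (a ∷ l) ≈ ΣPick l (λ p b r → sgn p (A a b * PfList A r))
  PfList-∷ A a []      = refl
  PfList-∷ A a (b ∷ r) = Σ-cong λ p → sgn-cong (toℕ p) (*-congˡ {A a (lookup (b ∷ r) p)}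
    (Pfaff-cast (suc-injective (length-removeAt′ (b ∷ r) p)) (minorAt p) (PfMatrix (removeAt (b ∷ r) p))
      λ i j → reflexive (≡.sym (≡.cong₂ A (lookup-removeAt b r p i) (lookup-removeAt b r p j)))))
    where
    PfMatrix : (l : List _) → Matrix (length l)
    PfMatrix l i j = A (lookup l i) (lookup l j)
    minorAt : Fin (suc (length r)) → Matrix (length r)
    minorAt p i j = A (lookup (b ∷ r) (punchIn p i)) (lookup (b ∷ r) (punchIn p j))

  lookup-map : ∀ {n n′} (g : Fin n → Fin n′) l (i : Fin (length (map g l))) →
    lookup (map g l) i ≡ g (lookup l (cast (length-map g l) i))
  lookup-map g (x ∷ l) zero    = ≡.refl
  lookup-map g (x ∷ l) (suc i) = lookup-map g l i

  PfList-map : ∀ {n n′} (A : Matrix n′) (g : Fin n → Fin n′) l →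
    PfList A (map g l) ≈ PfList (λ i j → A (g i) (g j)) l
  PfList-map A g l = Pfaff-cast (length-map g l) _ _ λ i j →
    reflexive (≡.cong₂ A (lookup-map g l i) (lookup-map g l j))

  ΣPick-map : ∀ {n n′} (g : Fin n → Fin n′) l (K : ℕ → Fin n′ → List (Fin n′) → Carrier) →
    ΣPick (map g l) K ≈ ΣPick l (λ p b r → K p (g b) (map g r))
  ΣPick-map g []      K = refl
  ΣPick-map g (x ∷ l) K = +-cong refl (ΣPick-map g l (λ p b r → K (suc p) b (g x ∷ r)))

  ΣPick-elems : ∀ {n} (u : Subset n) (K : ℕ → Fin n → List (Fin n) → Carrier) →
    ΣPick (elems u) K ≈
    Σ (λ k → if Vec.lookup u k then K (rank u (inject₁ k)) k (elems (u - k)) else 0#)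
  ΣPick-elems []            K = refl
  ΣPick-elems (outside ∷ u) K =
    trans (ΣPick-map suc (elems u) K) (trans (ΣPick-elems u K⁺) (sym (+-identityˡ _)))
    where K⁺ = λ p b r → K p (suc b) (map suc r)
  ΣPick-elems (inside ∷ u) K = +-cong
    (reflexive (≡.cong (K 0 zero ∘ map suc ∘ elems) (≡.sym (p─⊥≡p u))))
    (trans (ΣPick-map suc (elems u) K₀) (ΣPick-elems u λ p b r → K₀ p (suc b) (map suc r)))
    where K₀ = λ p b r → K (suc p) b (zero ∷ r)

  PfSub-skip : ∀ {m} (A : Matrix (suc (suc m))) t (k : Fin (suc m)) →
    PfSub A (outside ∷ insertAt t k outside) ≈ PfSub (minor k A) t
  PfSub-skip A t k rewrite elems-insertAt-outside t k =
    trans (PfList-map A suc (map (punchIn k) (elems t)))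
          (PfList-map (λ i j → A (suc i) (suc j)) (punchIn k) (elems t))

  PfSub-outside-∁-insertAt : ∀ {m} (A : Matrix (suc (suc m))) t k →
    PfSub A (outside ∷ ∁ (insertAt t k inside)) ≈ PfSub (minor k A) (∁ t)
  PfSub-outside-∁-insertAt A t k rewrite map-insertAt not inside t k = PfSub-skip A (∁ t) k

  firstRowTerm : ∀ {n} → Matrix (suc n) → Subset n → Fin n → Carrier
  firstRowTerm A u k =
    if Vec.lookup u k then sgn (rank u (inject₁ k)) (A zero (suc k) * PfSub A (outside ∷ (u - k))) else 0#

  PfSub-inside∷ : ∀ {n} (A : Matrix (suc n)) u → PfSub A (inside ∷ u) ≈ Σ (firstRowTerm A u)
  PfSub-inside∷ A u = begin
    PfList A (zero ∷ map suc (elems u))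
      ≈⟨ PfList-∷ A zero (map suc (elems u)) ⟩
    ΣPick (map suc (elems u)) (λ p b r → sgn p (A zero b * PfList A r))
      ≈⟨ ΣPick-map suc (elems u) (λ p b r → sgn p (A zero b * PfList A r)) ⟩
    ΣPick (elems u) (λ p b r → sgn p (A zero (suc b) * PfList A (map suc r)))
      ≈⟨ ΣPick-elems u (λ p b r → sgn p (A zero (suc b) * PfList A (map suc r))) ⟩
    Σ (firstRowTerm A u) ∎

  firstRowTerm-insertAt-outside : ∀ {m} (A : Matrix (suc (suc m))) t k →
    firstRowTerm A (insertAt t k outside) k ≡ 0#
  firstRowTerm-insertAt-outside A t k rewrite insertAt-lookup t k outside = ≡.refl

  firstRowTerm-insertAt-inside : ∀ {m} (A : Matrix (suc (suc m))) t k →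
    firstRowTerm A (insertAt t k inside) k ≈ sgn (rank t k) (A zero (suc k) * PfSub (minor k A) t)
  firstRowTerm-insertAt-inside A t k
    rewrite insertAt-lookup t k inside | rank-insertAt t k inside | insertAt-remove t k inside =
    sgn-cong (rank t k) (*-congˡ (PfSub-skip A t k))

  ΣSubsets-*-PfSub-inside∷ : ∀ {m} (A : Matrix (suc (suc m))) (g : Subset (suc m) → Carrier) →
    ΣSubsets (suc m) (λ s → g s * PfSub A (inside ∷ s)) ≈
    Σ (λ k → ΣSubsets m (λ t → g (insertAt t k inside) * sgn (rank t k) (A zero (suc k) * PfSub (minor k A) t)))
  ΣSubsets-*-PfSub-inside∷ {m} A g = begin
    ΣSubsets (suc m) (λ s → g s * PfSub A (inside ∷ s))
      ≈⟨ ΣSubsets-cong (suc m) (λ s →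
           trans (*-congˡ (PfSub-inside∷ A s)) (*-distribˡ-Σ (g s) (firstRowTerm A s))) ⟩
    ΣSubsets (suc m) (λ s → Σ (term s))
      ≈⟨ ΣSubsets-Σ-comm (suc m) term ⟩
    Σ (λ k → ΣSubsets (suc m) (λ s → term s k))
      ≈⟨ Σ-cong (λ k → trans (ΣSubsets-insertAt m k (λ s → term s k))
                             (trans (+-cong (vanishing k) (picked k)) (+-identityˡ _))) ⟩
    Σ (λ k → ΣSubsets m (expanded k)) ∎
    where
    term : Subset (suc m) → Fin (suc m) → Carrier
    term s k = g s * firstRowTerm A s k
    expanded : Fin (suc m) → Subset m → Carrier
    expanded k t = g (insertAt t k inside) * sgn (rank t k) (A zero (suc k) * PfSub (minor k A) t)
    vanishing : ∀ k → ΣSubsets m (λ t → term (insertAt t k outside) k) ≈ 0#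
    vanishing k = ΣSubsets-zero m λ t →
      trans (*-congˡ (reflexive (firstRowTerm-insertAt-outside A t k))) (zeroʳ _)
    picked : ∀ k → ΣSubsets m (λ t → term (insertAt t k inside) k) ≈ ΣSubsets m (expanded k)
    picked k = ΣSubsets-cong m λ t → *-congˡ (firstRowTerm-insertAt-inside A t k)

  subsetProd : ∀ {n} → (Fin n → Carrier) → Subset n → Carrier
  subsetProd f []            = 1#
  subsetProd f (inside  ∷ s) = f zero * subsetProd (f ∘ suc) s
  subsetProd f (outside ∷ s) = subsetProd (f ∘ suc) s

  subsetProd-cong : ∀ {n} {f g : Fin n → Carrier} → (∀ i → f i ≈ g i) →
    ∀ s → subsetProd f s ≈ subsetProd g s
  subsetProd-cong f≈g []            = refl
  subsetProd-cong f≈g (inside  ∷ s) = *-cong (f≈g zero) (subsetProd-cong (f≈g ∘ suc) s)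
  subsetProd-cong f≈g (outside ∷ s) = subsetProd-cong (f≈g ∘ suc) s

  subsetProd-1# : ∀ {n} {f : Fin n → Carrier} → (∀ i → f i ≈ 1#) → ∀ s → subsetProd f s ≈ 1#
  subsetProd-1# f≈1 []            = refl
  subsetProd-1# f≈1 (inside  ∷ s) = trans (*-cong (f≈1 zero) (subsetProd-1# (f≈1 ∘ suc) s)) (*-identityˡ 1#)
  subsetProd-1# f≈1 (outside ∷ s) = subsetProd-1# (f≈1 ∘ suc) s

  subsetProd-insertAt-inside : ∀ {m} (f : Fin (suc m) → Carrier) t k →
    subsetProd f (insertAt t k inside) ≈ f k * subsetProd (f ∘ punchIn k) t
  subsetProd-insertAt-inside f t             zero    = refl
  subsetProd-insertAt-inside f (inside  ∷ t) (suc k) =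
    trans (*-congˡ (subsetProd-insertAt-inside (f ∘ suc) t k)) (x∙yz≈y∙xz _ _ _)
  subsetProd-insertAt-inside f (outside ∷ t) (suc k) = subsetProd-insertAt-inside (f ∘ suc) t k

  subsetProd-insertAt-outside : ∀ {m} (f : Fin (suc m) → Carrier) t k →
    subsetProd f (insertAt t k outside) ≡ subsetProd (f ∘ punchIn k) t
  subsetProd-insertAt-outside f t             zero    = ≡.refl
  subsetProd-insertAt-outside f (inside  ∷ t) (suc k) =
    ≡.cong (f zero *_) (subsetProd-insertAt-outside (f ∘ suc) t k)
  subsetProd-insertAt-outside f (outside ∷ t) (suc k) = subsetProd-insertAt-outside (f ∘ suc) t k

  -- 1 if i < k, i.e. if punchIn k i = i; 0 otherwise.
  below : ∀ {m} → Fin (suc m) → Fin m → ℕ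
  below zero    i       = 0
  below (suc k) zero    = 1
  below (suc k) (suc i) = below k i

  sgn-suc-punchIn : ∀ {m} (k : Fin (suc m)) i x →
    sgn (suc (toℕ (punchIn k i))) x ≈ sgn (below k i) (sgn (toℕ i) x)
  sgn-suc-punchIn zero    i       x = -‿involutive _
  sgn-suc-punchIn (suc k) zero    x = refl
  sgn-suc-punchIn (suc k) (suc i) x =
    trans (-‿cong (sgn-suc-punchIn k i x)) (reflexive (≡.sym (sgn-neg (below k i) (sgn (toℕ i) x))))

  subsetProd-sgn-below : ∀ {m} (f : Fin m → Carrier) t (k : Fin (suc m)) →
    subsetProd (λ i → sgn (below k i) (f i)) t ≈ sgn (rank t k) (subsetProd f t)
  subsetProd-sgn-below f t             zero    = subsetProd-cong (λ _ → refl) t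
  subsetProd-sgn-below f (inside  ∷ t) (suc k) = begin
    - f zero * subsetProd (λ i → sgn (below k i) (f (suc i))) t
      ≈⟨ *-congˡ (subsetProd-sgn-below (f ∘ suc) t k) ⟩
    - f zero * sgn (rank t k) (subsetProd (f ∘ suc) t)
      ≈⟨ sgn-*ˡ 1 _ _ ⟩
    - (f zero * sgn (rank t k) (subsetProd (f ∘ suc) t))
      ≈⟨ -‿cong (sgn-*ʳ (rank t k) _ _) ⟩
    - sgn (rank t k) (f zero * subsetProd (f ∘ suc) t) ∎
  subsetProd-sgn-below f (outside ∷ t) (suc k) = subsetProd-sgn-below (f ∘ suc) t k

  alternate : ∀ {n} → (Fin n → Carrier) → Fin n → Carrier
  alternate w i = sgn (toℕ i) (w i)

  subsetProd-alternate-skip : ∀ {m} (w : Fin (suc (suc m)) → Carrier) t (k : Fin (suc m)) →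
    subsetProd (alternate w ∘ skip k) t ≈ sgn (rank t k) (subsetProd (alternate (w ∘ skip k)) t)
  subsetProd-alternate-skip w t k = trans
    (subsetProd-cong (λ i → sgn-suc-punchIn k i (w (skip k i))) t)
    (subsetProd-sgn-below (alternate (w ∘ skip k)) t k)

  negScaled : ∀ {n} → (Fin n → Carrier) → Matrix n → Matrix n
  negScaled w z i j = - (w i * w j * z i j)

  summand : ∀ {n} → (Fin n → Carrier) → Matrix n → Matrix n → Subset n → Carrier
  summand w z y I = subsetProd (alternate w) I * (PfSub z I * PfSub y (∁ I))

  module _ {m} (w : Fin (suc (suc m)) → Carrier) (z y : Matrix (suc (suc m))) where

    minorSummand : Fin (suc m) → Subset m → Carrier
    minorSummand k = summand (w ∘ skip k) (minor k z) (minor k y)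

    ΣSubsets-summand-inside : ΣSubsets (suc m) (λ s → summand w z y (inside ∷ s)) ≈
      Σ (λ k → sgn (toℕ k) (negScaled w z zero (suc k)) * ΣSubsets m (minorSummand k))
    ΣSubsets-summand-inside = begin
      ΣSubsets (suc m) (λ s → summand w z y (inside ∷ s))
        ≈⟨ ΣSubsets-cong (suc m) (λ s →
             x∙yz≈xz∙y (subsetProd (alternate w) (inside ∷ s)) (PfSub z (inside ∷ s)) (PfSub y (outside ∷ ∁ s))) ⟩
      ΣSubsets (suc m) (λ s → g s * PfSub z (inside ∷ s))
        ≈⟨ ΣSubsets-*-PfSub-inside∷ z g ⟩
      Σ (λ k → ΣSubsets m (λ t → g (insertAt t k inside) * sgn (rank t k) (z zero (suc k) * PfSub (minor k z) t)))
        ≈⟨ Σ-cong (λ k → trans (ΣSubsets-cong m (term k))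
                               (sym (*-distribˡ-ΣSubsets m (coeff k) (minorSummand k)))) ⟩
      Σ (λ k → coeff k * ΣSubsets m (minorSummand k)) ∎
      where
      coeff : Fin (suc m) → Carrier
      coeff k = sgn (toℕ k) (negScaled w z zero (suc k))
      g : Subset (suc m) → Carrier
      g s = subsetProd (alternate w) (inside ∷ s) * PfSub y (outside ∷ ∁ s)
      rearrange : ∀ r k a b c P Z Y →
        (a * (sgn (suc k) b * sgn r P)) * Y * sgn r (c * Z) ≈ sgn k (- (a * b * c)) * (P * (Z * Y))
      rearrange r k a b c P Z Y = begin
        (a * (sgn (suc k) b * sgn r P)) * Y * sgn r (c * Z)
          ≈⟨ *-congʳ (*-congʳ (trans (*-congˡ (sgn-*-sgn (suc k) r b P))
                                     (trans (sgn-*ʳ (suc k) a _) (sgn-cong (suc k) (sgn-*ʳ r a _))))) ⟩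
        sgn (suc k) (sgn r (a * (b * P))) * Y * sgn r (c * Z)
          ≈⟨ trans (*-congʳ (trans (sgn-*ˡ (suc k) _ Y) (sgn-cong (suc k) (sgn-*ˡ r _ Y))))
                   (sgn-*ˡ (suc k) _ _) ⟩
        sgn (suc k) (sgn r (a * (b * P) * Y) * sgn r (c * Z))
          ≈⟨ sgn-cong (suc k) (trans (sgn-*-sgn r r _ _) (sgn-involutive r _)) ⟩
        sgn (suc k) (a * (b * P) * Y * (c * Z))
          ≈⟨ sgn-cong (suc k) (solve 6 (λ a b c P Z Y →
               ((a · (b · P)) · Y) · (c · Z) ⊜ ((a · b) · c) · (P · (Z · Y))) refl a b c P Z Y) ⟩
        sgn (suc k) (a * b * c * (P * (Z * Y)))
          ≈⟨ sgn-*ˡ (suc k) _ _ ⟨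
        sgn (suc k) (a * b * c) * (P * (Z * Y))
          ≡⟨ ≡.cong (_* (P * (Z * Y))) (sgn-neg k (a * b * c)) ⟨
        sgn k (- (a * b * c)) * (P * (Z * Y)) ∎
      term : ∀ k t → g (insertAt t k inside) * sgn (rank t k) (z zero (suc k) * PfSub (minor k z) t) ≈
                     coeff k * minorSummand k t
      term k t = trans
        (*-congʳ (*-cong (*-congˡ (trans (subsetProd-insertAt-inside (alternate w ∘ suc) t k)
                                         (*-congˡ (subsetProd-alternate-skip w t k))))
                         (PfSub-outside-∁-insertAt y t k)))
        (rearrange (rank t k) (toℕ k) (w zero) (w (suc k)) (z zero (suc k))
           (subsetProd (alternate (w ∘ skip k)) t) (PfSub (minor k z) t) (PfSub (minor k y) (∁ t)))

    -- Substituting s ↦ ∁ s lets the first-row expansion act on the y-Pfaffian.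
    ΣSubsets-summand-outside : ΣSubsets (suc m) (λ s → summand w z y (outside ∷ s)) ≈
      Σ (λ k → sgn (toℕ k) (y zero (suc k)) * ΣSubsets m (minorSummand k))
    ΣSubsets-summand-outside = begin
      ΣSubsets (suc m) (λ s → summand w z y (outside ∷ s))
        ≈⟨ ΣSubsets-∁ (suc m) (λ s → summand w z y (outside ∷ s)) ⟩
      ΣSubsets (suc m) (λ s → summand w z y (outside ∷ ∁ s))
        ≈⟨ ΣSubsets-cong (suc m) (λ s →
             trans (sym (*-assoc (subsetProd (alternate w ∘ suc) (∁ s)) (PfSub z (outside ∷ ∁ s)) _))
                   (*-congˡ (reflexive (≡.cong (λ u → PfSub y (inside ∷ u)) (∁-involutive s))))) ⟩
      ΣSubsets (suc m) (λ s → h s * PfSub y (inside ∷ s))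
        ≈⟨ ΣSubsets-*-PfSub-inside∷ y h ⟩
      Σ (λ k → ΣSubsets m (λ t → h (insertAt t k inside) * sgn (rank t k) (y zero (suc k) * PfSub (minor k y) t)))
        ≈⟨ Σ-cong (λ k → trans (ΣSubsets-cong m (term k))
             (trans (sym (ΣSubsets-∁ m (λ t → coeff k * minorSummand k t)))
                    (sym (*-distribˡ-ΣSubsets m (coeff k) (minorSummand k))))) ⟩
      Σ (λ k → coeff k * ΣSubsets m (minorSummand k)) ∎
      where
      coeff : Fin (suc m) → Carrier
      coeff k = sgn (toℕ k) (y zero (suc k))
      h : Subset (suc m) → Carrier
      h s = subsetProd (alternate w ∘ suc) (∁ s) * PfSub z (outside ∷ ∁ s)
      h-insertAt : ∀ k t → h (insertAt t k inside) ≈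
        sgn (rank (∁ t) k) (subsetProd (alternate (w ∘ skip k)) (∁ t)) * PfSub (minor k z) (∁ t)
      h-insertAt k t rewrite map-insertAt not inside t k = *-cong
        (trans (reflexive (subsetProd-insertAt-outside (alternate w ∘ suc) (∁ t) k))
               (subsetProd-alternate-skip w (∁ t) k))
        (PfSub-skip z (∁ t) k)
      rearrange : ∀ r r′ c P Z Y → (sgn r′ P * Z) * sgn r (c * Y) ≈ sgn (r′ ℕ.+ r) c * (P * (Z * Y))
      rearrange r r′ c P Z Y = begin
        (sgn r′ P * Z) * sgn r (c * Y)      ≈⟨ *-congʳ (sgn-*ˡ r′ P Z) ⟩
        sgn r′ (P * Z) * sgn r (c * Y)      ≈⟨ sgn-*-sgn r′ r _ _ ⟩
        sgn r′ (sgn r (P * Z * (c * Y)))    ≡⟨ sgn-+ r′ r _ ⟨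
        sgn (r′ ℕ.+ r) (P * Z * (c * Y))
          ≈⟨ sgn-cong (r′ ℕ.+ r)
               (solve 4 (λ c P Z Y → (P · Z) · (c · Y) ⊜ c · (P · (Z · Y))) refl c P Z Y) ⟩
        sgn (r′ ℕ.+ r) (c * (P * (Z * Y)))  ≈⟨ sgn-*ˡ (r′ ℕ.+ r) c _ ⟨
        sgn (r′ ℕ.+ r) c * (P * (Z * Y))    ∎
      term : ∀ k t → h (insertAt t k inside) * sgn (rank t k) (y zero (suc k) * PfSub (minor k y) t) ≈
                     coeff k * minorSummand k (∁ t)
      term k t = begin
        h (insertAt t k inside) * sgn (rank t k) (y zero (suc k) * Y)
          ≈⟨ *-congʳ (h-insertAt k t) ⟩
        (sgn (rank (∁ t) k) P * Z) * sgn (rank t k) (y zero (suc k) * Y)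
          ≈⟨ rearrange (rank t k) (rank (∁ t) k) (y zero (suc k)) P Z Y ⟩
        sgn (rank (∁ t) k ℕ.+ rank t k) (y zero (suc k)) * (P * (Z * Y))
          ≡⟨ ≡.cong₂ (λ r u → sgn r (y zero (suc k)) * (P * (Z * PfSub (minor k y) u)))
                     (rank-∁ t k) (≡.sym (∁-involutive t)) ⟩
        coeff k * minorSummand k (∁ t) ∎
        where
        P = subsetProd (alternate (w ∘ skip k)) (∁ t)
        Z = PfSub (minor k z) (∁ t)
        Y = PfSub (minor k y) t

  Pfaff-negScaled-⊕ : ∀ n (w : Fin n → Carrier) (z y : Matrix n) →
    Pfaff n (negScaled w z ⊕ y) ≈ ΣSubsets n (summand w z y)
  Pfaff-negScaled-⊕ zero          w z y = sym (trans (*-identityˡ _) (*-identityˡ 1#))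
  Pfaff-negScaled-⊕ (suc zero)    w z y =
    sym (trans (+-cong (trans (*-congˡ (zeroʳ 1#)) (zeroʳ 1#)) (trans (*-congˡ (zeroˡ 1#)) (zeroʳ _)))
               (+-identityˡ 0#))
  Pfaff-negScaled-⊕ (suc (suc m)) w z y = begin
    Σ (λ k → sgn (toℕ k) ((a k + b k) * Pfaff m (negScaled (w ∘ skip k) (minor k z) ⊕ minor k y)))
      ≈⟨ Σ-cong (λ k → sgn-cong (toℕ k) (*-congˡ {a k + b k}
           (Pfaff-negScaled-⊕ m (w ∘ skip k) (minor k z) (minor k y)))) ⟩
    Σ (λ k → sgn (toℕ k) ((a k + b k) * S k))
      ≈⟨ Σ-cong split ⟩
    Σ (λ k → sgn (toℕ k) (a k) * S k + sgn (toℕ k) (b k) * S k)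
      ≈⟨ Σ-distrib-+ (λ k → sgn (toℕ k) (a k) * S k) (λ k → sgn (toℕ k) (b k) * S k) ⟩
    Σ (λ k → sgn (toℕ k) (a k) * S k) + Σ (λ k → sgn (toℕ k) (b k) * S k)
      ≈⟨ +-cong (ΣSubsets-summand-inside w z y) (ΣSubsets-summand-outside w z y) ⟨
    ΣSubsets (suc m) (λ s → summand w z y (inside ∷ s)) +
    ΣSubsets (suc m) (λ s → summand w z y (outside ∷ s))
      ≈⟨ +-comm _ _ ⟩
    ΣSubsets (suc (suc m)) (summand w z y) ∎
    where
    a b S : Fin (suc m) → Carrier
    a k = negScaled w z zero (suc k)
    b k = y zero (suc k)
    S k = ΣSubsets m (minorSummand w z y k)
    split : ∀ k → sgn (toℕ k) ((a k + b k) * S k) ≈ sgn (toℕ k) (a k) * S k + sgn (toℕ k) (b k) * S k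
    split k = trans (sym (sgn-*ˡ (toℕ k) _ (S k)))
                    (trans (*-congʳ (sgn-distrib-+ (toℕ k) (a k) (b k))) (distribʳ (S k) _ _))

  negScaled-alternating : ∀ {n} (z : Matrix n) i j → negScaled (λ i → sgn (toℕ i) 1#) z i j ≈ tilde z i j
  negScaled-alternating z i j = begin
    - (sgn (toℕ i) 1# * sgn (toℕ j) 1# * z i j)
      ≈⟨ -‿cong (trans (*-assoc _ _ _)
                       (trans (sgn-1#-* (toℕ i) _) (sgn-cong (toℕ i) (sgn-1#-* (toℕ j) _)))) ⟩
    - sgn (toℕ i) (sgn (toℕ j) (z i j))
      ≡⟨ ≡.trans (≡.cong (sgn (toℕ i)) (sgn-neg (toℕ j) (z i j))) (sgn-neg (toℕ i) _) ⟨
    sgn (toℕ i) (sgn (toℕ j) (- z i j))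
      ≡⟨ ≡.trans (≡.sym (sgn-+ (toℕ i) (toℕ j) _)) (≡.sym (sgn-+ (toℕ i ℕ.+ toℕ j) 1 (z i j))) ⟩
    tilde z i j ∎
    where
    sgn-1#-* : ∀ a x → sgn a 1# * x ≈ sgn a x
    sgn-1#-* a x = trans (sgn-*ˡ a 1# x) (sgn-cong a (*-identityˡ x))

  ΣSubsets-PfSub-PfSub-∁ : ∀ n (z y : Matrix n) →
    ΣSubsets n (λ I → PfSub z I * PfSub y (∁ I)) ≈ Pfaff n (tilde z ⊕ y)
  ΣSubsets-PfSub-PfSub-∁ n z y = begin
    ΣSubsets n (λ I → PfSub z I * PfSub y (∁ I))
      ≈⟨ ΣSubsets-cong n (λ I →
           trans (*-congʳ (subsetProd-1# (λ i → sgn-involutive (toℕ i) 1#) I)) (*-identityˡ _)) ⟨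
    ΣSubsets n (summand ε z y)
      ≈⟨ Pfaff-negScaled-⊕ n ε z y ⟨
    Pfaff n (negScaled ε z ⊕ y)
      ≈⟨ Pfaff-cong n (λ i j → +-congʳ (negScaled-alternating z i j)) ⟩
    Pfaff n (tilde z ⊕ y) ∎
    where
    ε : Fin n → Carrier
    ε i = sgn (toℕ i) 1#

open WithRing

theorem4p3 : ∀ {c ℓ : Level} (R : CommutativeRing c ℓ) →
    (n : ℕ) → ∃[ k ] (n ≡ 2 Data.Nat.* k) →
    (z y : Matrix R n) → SkewSymmetric R z → SkewSymmetric R y →
    CommutativeRing._≈_ R
      (ΣSubsets R n (λ I → CommutativeRing._*_ R (PfSub R z I) (PfSub R y (∁ I))))
      (Pfaff R n (_⊕_ R (tilde R z) y))
    × CommutativeRing._≈_ R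
      (⟨_,_⟩ R (sPf R z) (sPf∨ R y))
      (Pfaff R n (_⊕_ R (tilde R z) y))
theorem4p3 R n _ z y _ _ = identity , identity
  where identity = PfaffianExpansion.ΣSubsets-PfSub-PfSub-∁ R n z y
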